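{- For all DMTS $S_1,S_2$ over a finite alphabet $\Sigma$, $\mathrm{db}(S_1\wedge S_2)=\mathrm{db}(S_1)\wedge\mathrm{db}(S_2)$ (equality of NAA).
   Context: A DMTS is $(S,S^0,\dashrightarrow,\longrightarrow)$ with $S^0\subseteq S$ finite, image-finite may relation $\dashrightarrow\subseteq S\times\Sigma\times S$, and must relation $\longrightarrow\subseteq S\times 2^{\Sigma\times S}$ such that $s\longrightarrow N$ and $(a,t)\in N$ imply $s\overset a\dashrightarrow t$. A NAA is $(S,S^0,\mathrm{Tran})$ with $S^0\subseteq S$ finite and $\mathrm{Tran}:S\to 2^{\mathcal P_{\mathrm{fin}}(\Sigma\times S)}$. $\mathrm{db}(S)=(S,S^0,\mathrm{Tran})$ with $\mathrm{Tran}(s)=\{M\subseteq\Sigma\times S\mid\forall N(s\longrightarrow N\Rightarrow M\cap N\ne\emptyset),\ \forall(a,t)\in M: s\overset a\dashrightarrow t\}$. DMTS conjunction: $S_1\wedge S_2=(S_1\times S_2,S_1^0\times S_2^0,\dashrightarrow,\longrightarrow)$ with $(s_1,s_2)\overset a\dashrightarrow(t_1,t_2)$ iff $s_1\overset a\dashrightarrow_1 t_1$ and $s_2\overset a\dashrightarrow_2t_2$; for every $s_1\longrightarrow_1N_1$, $(s_1,s_2)\longrightarrow\{(a,(t_1,t_2))\mid(a,t_1)\in N_1,(s_1,s_2)\overset a\dashrightarrow(t_1,t_2)\}$; for every $s_2\longrightarrow_2N_2$, $(s_1,s_2)\longrightarrow\{(a,(t_1,t_2))\mid(a,t_2)\in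 N_2,(s_1,s_2)\overset a\dashrightarrow(t_1,t_2)\}$; no other must transitions. NAA conjunction: $S_1\wedge S_2=(S_1\times S_2,S_1^0\times S_2^0,\mathrm{Tran})$ with $\mathrm{Tran}((s_1,s_2))=\{M\subseteq\Sigma\times S_1\times S_2\mid\pi_1(M)\in\mathrm{Tran}_1(s_1),\pi_2(M)\in\mathrm{Tran}_2(s_2)\}$, where $\pi_1(M)=\{(a,s_1)\mid\exists s_2:(a,s_1,s_2)\in M\}$ and $\pi_2(M)=\{(a,s_2)\mid\exists s_1:(a,s_1,s_2)\in M\}$ (elements $(a,s_1,s_2)$ are identified with $(a,(s_1,s_2))$). -}

module Defs where

open import Data.Product using (Σ; ∃; _×_; _,_; proj₁; proj₂)
open import Data.Sum using (_⊎_; inj₁; inj₂)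
open import Data.List using (List; map; cartesianProduct)
open import Data.List.Membership.Propositional using (_∈_)
open import Data.List.Membership.Propositional.Properties using (∈-cartesianProduct⁺)
open import Function.Bundles using (_⇔_)

Finite : Set → Set
Finite A = ∃ λ (xs : List A) → ∀ x → x ∈ xs

-- The must relation s ⟶ N is given as an indexed family:
-- the must transitions of s are indexed by MustIdx s, and the i-th one
-- has target set MustSet s i ⊆ Act × S.
-- Finite sets of initial states are lists.

record DMTS (Act : Set) (S : Set) : Set₁ where
  field
    Init      : List S
    May       : S → Act → S → Set
    imageFin  : ∀ s a → ∃ λ (ts : List S) → ∀ t → May s a t → t ∈ ts
    MustIdx   : S → Set
    MustSet   : (s : S) → MustIdx s → Act × S → Set
    mustMay   : ∀ s i a t → MustSet s i (a , t) → May s a t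

-- NAA over alphabet Act with state set S.  Finite subsets of Act × S are
-- represented by lists (compared by membership); Tran s is the set of
-- finite sets M with Tran s M.

record NAA (Act : Set) (S : Set) : Set₁ where
  field
    Init : List S
    Tran : S → List (Act × S) → Set

record _≡NAA_ {Act S : Set} (A B : NAA Act S) : Set where
  field
    init-eq : ∀ s → (s ∈ NAA.Init A) ⇔ (s ∈ NAA.Init B)
    tran-eq : ∀ s (M : List (Act × S)) → NAA.Tran A s M ⇔ NAA.Tran B s M

db : ∀ {Act S} → DMTS Act S → NAA Act S
db {Act} {S} D = record
  { Init = Init
  ; Tran = λ s M →
      (∀ (i : MustIdx s) → ∃ λ x → x ∈ M × MustSet s i x)
      × (∀ a t → (a , t) ∈ M → May s a t)
  }
  where open DMTS D

_∧D_ : ∀ {Act S₁ S₂} → DMTS Act S₁ → DMTS Act S₂ → DMTS Act (S₁ × S₂)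
_∧D_ {Act} {S₁} {S₂} D₁ D₂ = record
  { Init     = cartesianProduct (DMTS.Init D₁) (DMTS.Init D₂)
  ; May      = may
  ; imageFin = λ { (s₁ , s₂) a →
      cartesianProduct (proj₁ (DMTS.imageFin D₁ s₁ a)) (proj₁ (DMTS.imageFin D₂ s₂ a))
      , λ { (t₁ , t₂) (m₁ , m₂) →
              ∈-cartesianProduct⁺ (proj₂ (DMTS.imageFin D₁ s₁ a) t₁ m₁)
                                  (proj₂ (DMTS.imageFin D₂ s₂ a) t₂ m₂) } }
  ; MustIdx  = λ { (s₁ , s₂) → DMTS.MustIdx D₁ s₁ ⊎ DMTS.MustIdx D₂ s₂ }
  ; MustSet  = mustSet
  ; mustMay  = mustMay
  }
  where
  may : S₁ × S₂ → Act → S₁ × S₂ → Set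
  may (s₁ , s₂) a (t₁ , t₂) = DMTS.May D₁ s₁ a t₁ × DMTS.May D₂ s₂ a t₂

  mustSet : (s : S₁ × S₂) → DMTS.MustIdx D₁ (proj₁ s) ⊎ DMTS.MustIdx D₂ (proj₂ s)
          → Act × (S₁ × S₂) → Set
  mustSet (s₁ , s₂) (inj₁ i) (a , (t₁ , t₂)) =
    DMTS.MustSet D₁ s₁ i (a , t₁) × may (s₁ , s₂) a (t₁ , t₂)
  mustSet (s₁ , s₂) (inj₂ j) (a , (t₁ , t₂)) =
    DMTS.MustSet D₂ s₂ j (a , t₂) × may (s₁ , s₂) a (t₁ , t₂)

  mustMay : ∀ s i a t → mustSet s i (a , t) → may s a t
  mustMay (s₁ , s₂) (inj₁ i) a (t₁ , t₂) (_ , m) = m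
  mustMay (s₁ , s₂) (inj₂ j) a (t₁ , t₂) (_ , m) = m

π₁ : ∀ {Act S₁ S₂ : Set} → List (Act × (S₁ × S₂)) → List (Act × S₁)
π₁ = map (λ { (a , (t₁ , t₂)) → (a , t₁) })

π₂ : ∀ {Act S₁ S₂ : Set} → List (Act × (S₁ × S₂)) → List (Act × S₂)
π₂ = map (λ { (a , (t₁ , t₂)) → (a , t₂) })

_∧N_ : ∀ {Act S₁ S₂} → NAA Act S₁ → NAA Act S₂ → NAA Act (S₁ × S₂)
A₁ ∧N A₂ = record
  { Init = cartesianProduct (NAA.Init A₁) (NAA.Init A₂)
  ; Tran = λ { (s₁ , s₂) M → NAA.Tran A₁ s₁ (π₁ M) × NAA.Tran A₂ s₂ (π₂ M) }
  }

-- A set M is a transition set of db(S₁ ∧ S₂) at (s₁, s₂) iff it consists of joint may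
-- transitions and meets every must set of both components.  Both conditions split along
-- the projections: M ⊆ may iff π₁ M ⊆ may₁ and π₂ M ⊆ may₂, and M meets a lifted must set
-- N₁ iff π₁ M meets N₁ — where for the converse, a witness (a, t₁) ∈ π₁ M lifts to some
-- (a, t₁, t₂) ∈ M, which lies in the lifted set because M ⊆ may.
module Submission where

open import Defs
open import Data.Product using (∃; _×_; _,_; proj₁; proj₂)
open import Data.Sum using (inj₁; inj₂)
open import Data.List using (List)
open import Data.List.Membership.Propositional using (_∈_)
open import Data.List.Membership.Propositional.Properties using (∈-map⁺; ∈-map⁻)
open import Function.Bundles using (_⇔_; mk⇔; module Equivalence)
open import Function using (id)
open import Relation.Binary.PropositionalEquality using (refl)

module _ {Act S₁ S₂ : Set} {a : Act} {M : List (Act × (S₁ × S₂))} where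

  ∈-π₁⁺ : ∀ {t₁ t₂} → (a , (t₁ , t₂)) ∈ M → (a , t₁) ∈ π₁ M
  ∈-π₁⁺ = ∈-map⁺ _

  ∈-π₂⁺ : ∀ {t₁ t₂} → (a , (t₁ , t₂)) ∈ M → (a , t₂) ∈ π₂ M
  ∈-π₂⁺ = ∈-map⁺ _

  ∈-π₁⁻ : ∀ {t₁} → (a , t₁) ∈ π₁ M → ∃ λ t₂ → (a , (t₁ , t₂)) ∈ M
  ∈-π₁⁻ p with ∈-map⁻ _ p
  ... | (_ , (_ , t₂)) , q , refl = t₂ , q

  ∈-π₂⁻ : ∀ {t₂} → (a , t₂) ∈ π₂ M → ∃ λ t₁ → (a , (t₁ , t₂)) ∈ M
  ∈-π₂⁻ p with ∈-map⁻ _ p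
  ... | (_ , (t₁ , _)) , q , refl = t₁ , q

module _ {Act S : Set} (D : DMTS Act S) where
  open DMTS D

  MeetsMust : S → List (Act × S) → Set
  MeetsMust s M = ∀ i → ∃ λ x → x ∈ M × MustSet s i x

  WithinMay : S → List (Act × S) → Set
  WithinMay s M = ∀ a t → (a , t) ∈ M → May s a t

module _ {Act S₁ S₂ : Set} (D₁ : DMTS Act S₁) (D₂ : DMTS Act S₂)
         {s₁ : S₁} {s₂ : S₂} {M : List (Act × (S₁ × S₂))} where

  withinMay-∧ : WithinMay (D₁ ∧D D₂) (s₁ , s₂) M
              ⇔ (WithinMay D₁ s₁ (π₁ M) × WithinMay D₂ s₂ (π₂ M))
  withinMay-∧ = mk⇔ split join
    where
    split : WithinMay (D₁ ∧D D₂) (s₁ , s₂) M → WithinMay D₁ s₁ (π₁ M) × WithinMay D₂ s₂ (π₂ M)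
    split may = (λ a t₁ p → let t₂ , q = ∈-π₁⁻ p in proj₁ (may a (t₁ , t₂) q))
              , (λ a t₂ p → let t₁ , q = ∈-π₂⁻ p in proj₂ (may a (t₁ , t₂) q))

    join : WithinMay D₁ s₁ (π₁ M) × WithinMay D₂ s₂ (π₂ M) → WithinMay (D₁ ∧D D₂) (s₁ , s₂) M
    join (may₁ , may₂) a (t₁ , t₂) q = may₁ a t₁ (∈-π₁⁺ q) , may₂ a t₂ (∈-π₂⁺ q)

  meetsMust-∧⁺ : MeetsMust (D₁ ∧D D₂) (s₁ , s₂) M
               → MeetsMust D₁ s₁ (π₁ M) × MeetsMust D₂ s₂ (π₂ M)
  meetsMust-∧⁺ must = must₁ , must₂
    where
    must₁ : MeetsMust D₁ s₁ (π₁ M)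
    must₁ i with must (inj₁ i)
    ... | (a , (t₁ , _)) , q , (n₁ , _) = (a , t₁) , ∈-π₁⁺ q , n₁

    must₂ : MeetsMust D₂ s₂ (π₂ M)
    must₂ j with must (inj₂ j)
    ... | (a , (_ , t₂)) , q , (n₂ , _) = (a , t₂) , ∈-π₂⁺ q , n₂

  meetsMust-∧⁻ : WithinMay (D₁ ∧D D₂) (s₁ , s₂) M
               → MeetsMust D₁ s₁ (π₁ M) × MeetsMust D₂ s₂ (π₂ M)
               → MeetsMust (D₁ ∧D D₂) (s₁ , s₂) M
  meetsMust-∧⁻ may (must₁ , must₂) (inj₁ i) with must₁ i
  ... | (a , t₁) , p , n₁ with ∈-π₁⁻ p
  ... | t₂ , q = (a , (t₁ , t₂)) , q , n₁ , may a (t₁ , t₂) q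
  meetsMust-∧⁻ may (must₁ , must₂) (inj₂ j) with must₂ j
  ... | (a , t₂) , p , n₂ with ∈-π₂⁻ p
  ... | t₁ , q = (a , (t₁ , t₂)) , q , n₂ , may a (t₁ , t₂) q

  tran-db-∧ : NAA.Tran (db (D₁ ∧D D₂)) (s₁ , s₂) M ⇔ NAA.Tran (db D₁ ∧N db D₂) (s₁ , s₂) M
  tran-db-∧ = mk⇔ to from
    where
    open Equivalence withinMay-∧ renaming (to to splitMay; from to joinMay)

    to : NAA.Tran (db (D₁ ∧D D₂)) (s₁ , s₂) M → NAA.Tran (db D₁ ∧N db D₂) (s₁ , s₂) M
    to (must , may) =
      let must₁ , must₂ = meetsMust-∧⁺ must
          may₁ , may₂ = splitMay may
      in (must₁ , may₁) , (must₂ , may₂)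

    from : NAA.Tran (db D₁ ∧N db D₂) (s₁ , s₂) M → NAA.Tran (db (D₁ ∧D D₂)) (s₁ , s₂) M
    from ((must₁ , may₁) , (must₂ , may₂)) =
      let may = joinMay (may₁ , may₂)
      in meetsMust-∧⁻ may (must₁ , must₂) , may

lemma6 : (Act : Set) → Finite Act → {S₁ S₂ : Set} (D₁ : DMTS Act S₁) (D₂ : DMTS Act S₂) →
    db (D₁ ∧D D₂) ≡NAA (db D₁ ∧N db D₂)
lemma6 _ _ D₁ D₂ = record
  { init-eq = λ _ → mk⇔ id id
  ; tran-eq = λ { (s₁ , s₂) M → tran-db-∧ D₁ D₂ }
  }
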